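{- For every integer $n\ge 0$, $$\det\left(\begin{bmatrix} i+1\\ j+1\end{bmatrix}x^2-\begin{bmatrix} i\\ j-1\end{bmatrix}\right)_{i,j=0}^{n-1}=x^nG_n(x),$$ where $G_n(x)=\sum_{j=0}^{\lfloor n/2\rfloor}q^{j^2}\begin{bmatrix} n-j\\ j\end{bmatrix}x^{n-2j}$.
   Context: For integers $a\ge 0$ and $m$, the $q$-binomial coefficient is $\begin{bmatrix} a\\ m\end{bmatrix}=\frac{(1-q^a)(1-q^{a-1})\cdots(1-q^{a-m+1})}{(1-q)(1-q^2)\cdots(1-q^m)}$ for $0\le m\le a$ and $0$ otherwise. The determinant of a $0\times 0$ matrix is $1$. -}

module Defs where

open import Level using (Level)
open import Algebra.Bundles using (CommutativeRing)
open import Data.Nat using (ℕ; zero; suc; _∸_; _/_)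
open import Data.Integer using (ℤ; +_; -[1+_])
open import Data.Fin using (Fin; zero; suc; toℕ; punchIn)

module _ {c ℓ : Level} (R : CommutativeRing c ℓ) where
  open CommutativeRing R using (Carrier; _+_; _*_; -_; _-_; 0#; 1#)

  pow : Carrier → ℕ → Carrier
  pow x zero    = 1#
  pow x (suc k) = x * pow x k

  ΣFin : (n : ℕ) → (Fin n → Carrier) → Carrier
  ΣFin zero    f = 0#
  ΣFin (suc n) f = f zero + ΣFin n (λ j → f (suc j))

  sumTo : ℕ → (ℕ → Carrier) → Carrier
  sumTo zero    f = f 0
  sumTo (suc k) f = sumTo k f + f (suc k)

  sgn : ℕ → Carrier
  sgn zero    = 1#
  sgn (suc k) = - sgn k

  det : (n : ℕ) → (Fin n → Fin n → Carrier) → Carrier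
  det zero    M = 1#
  det (suc n) M =
    ΣFin (suc n) (λ j → sgn (toℕ j) * (M zero j * det n (λ a b → M (suc a) (punchIn j b))))

  -- Gaussian binomial [a, m] as a polynomial in q (q-Pascal recursion)
  qbin : Carrier → ℕ → ℕ → Carrier
  qbin q zero    zero    = 1#
  qbin q zero    (suc m) = 0#
  qbin q (suc a) zero    = 1#
  qbin q (suc a) (suc m) = qbin q a m + pow q (suc m) * qbin q a (suc m)

  qbinℤ : Carrier → ℕ → ℤ → Carrier
  qbinℤ q a (+ m)    = qbin q a m
  qbinℤ q a -[1+ m ] = 0#

  propMatrix : Carrier → Carrier → (n : ℕ) → Fin n → Fin n → Carrier
  propMatrix q x n i j =
    qbin q (suc (toℕ i)) (suc (toℕ j)) * (x * x)
      - qbinℤ q (toℕ i) (Data.Integer._-_ (+ toℕ j) (+ 1))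

  G : Carrier → Carrier → ℕ → Carrier
  G q x n = sumTo (n / 2)
    (λ j → pow q (Data.Nat._*_ j j) * (qbin q (n ∸ j) j * pow x (n ∸ Data.Nat._*_ 2 j)))

{-# OPTIONS --safe #-}
-- The matrix is lower Hessenberg with −1 on the superdiagonal, so its leading principal minors
-- D n obey D (n+1) = Σ_{k≤n} a_{nk} D k with D 0 = 1, and this determines them.  The q-Pascal rule
-- [n+1, k+1] = [n, k] + q^{k+1} [n, k+1] makes the same row relation hold for every sequence with
-- K 1 = x² K 0 and K (n+2) = x² K (n+1) + q^{n+1} x² K n.  Finally K n = xⁿ G n satisfies this,
-- because G (n+2) = x G (n+1) + q^{n+1} G n follows termwise from the dual rule
-- [a+1, m+1] = [a, m+1] + q^{a−m} [a, m].
module Submission where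

open import Defs
open import Level using (Level)
open import Algebra.Bundles using (CommutativeRing)
open import Data.Nat as ℕ using (ℕ; zero; suc)
import Data.Nat.Properties as ℕₚ
open import Data.Nat.DivMod using (_/_; m*n/n≡m; /-monoˡ-≤; m/n≤m)
open import Data.Nat.Induction using (<-rec)
import Data.Integer as ℤ
open import Data.Fin using (Fin; toℕ; punchIn)
open import Data.Fin.Properties using (toℕ<n; toℕ-inject₁; toℕ-fromℕ)
open import Data.Product using (_,_)
open import Data.Sum using (inj₁; inj₂)
open import Function using (_∘_)
open import Relation.Binary.PropositionalEquality as ≡ using (_≡_)
open import Relation.Nullary using (yes; no)

module Arithmetic where
  open import Data.Nat
  open import Data.Nat.Properties
  open import Data.Nat.Tactic.RingSolver using (solve-∀)

  /2<⇒<2* : ∀ {n i} → n / 2 < i → n < 2 * i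
  /2<⇒<2* {n} {i} n/2<i = ≰⇒> λ 2i≤n → <⇒≱ n/2<i (i≤n/2 2i≤n)
    where
    i≤n/2 : 2 * i ≤ n → i ≤ n / 2
    i≤n/2 2i≤n = ≡.subst (_≤ n / 2) (m*n/n≡m i 2) (/-monoˡ-≤ 2 (≡.subst (_≤ n) (*-comm 2 i) 2i≤n))

  2*j+b∸j≡j+b : ∀ j b → 2 * j + b ∸ j ≡ j + b
  2*j+b∸j≡j+b j b = ≡.trans (≡.cong (_∸ j) (2*j+b≡j+[j+b] j b)) (m+n∸m≡n j (j + b))
    where
    2*j+b≡j+[j+b] : ∀ j b → 2 * j + b ≡ j + (j + b)
    2*j+b≡j+[j+b] = solve-∀

  n<2*j⇒n∸j<j : ∀ {n j} → n < 2 * j → n ∸ j < j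
  n<2*j⇒n∸j<j {n} {suc j} n<2j =
    m<n+o⇒m∸n<o n (suc j) (≡.subst (n <_) (≡.cong (suc j +_) (+-identityʳ (suc j))) n<2j)

  n<2*j⇒2+n<2*[1+j] : ∀ {n j} → n < 2 * j → 2 + n < 2 * suc j
  n<2*j⇒2+n<2*[1+j] {n} {j} n<2j = ≡.subst (2 + n <_) (2+2*j≡2*[1+j] j) (s≤s (s≤s n<2j))
    where
    2+2*j≡2*[1+j] : ∀ j → 2 + 2 * j ≡ 2 * suc j
    2+2*j≡2*[1+j] = solve-∀

  1+[2*j+0]<2*[1+j] : ∀ j → suc (2 * j + 0) < 2 * suc j
  1+[2*j+0]<2*[1+j] j = ≡.subst (suc (2 * j + 0) <_) (2+[2*j+0]≡2*[1+j] j) (n<1+n _)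
    where
    2+[2*j+0]≡2*[1+j] : ∀ j → 2 + (2 * j + 0) ≡ 2 * suc j
    2+[2*j+0]≡2*[1+j] = solve-∀

  2+[2*j+b]≡2*[1+j]+b : ∀ j b → 2 + (2 * j + b) ≡ 2 * suc j + b
  2+[2*j+b]≡2*[1+j]+b = solve-∀

  1+[2*j+[1+b]]≡2*[1+j]+b : ∀ j b → suc (2 * j + suc b) ≡ 2 * suc j + b
  1+[2*j+[1+b]]≡2*[1+j]+b = solve-∀

  1+[2*j+b]+j*j≡[1+j]*[1+j]+b : ∀ j b → suc (2 * j + b) + j * j ≡ suc j * suc j + b
  1+[2*j+b]+j*j≡[1+j]*[1+j]+b = solve-∀

open Arithmetic

module _ {c ℓ : Level} (R : CommutativeRing c ℓ) where
  open CommutativeRing R hiding (zero)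
  open import Algebra.Properties.Ring ring using (-1*x≈-x; -0#≈0#; -‿involutive; -‿distribˡ-*; xyx⁻¹≈y)
  open import Algebra.Properties.CommutativeSemigroup +-commutativeSemigroup using (interchange)
  open import Algebra.Properties.Semiring.Sum semiring using (sum; sum-cong-≋; sum-cong-≗; sum-init-last; *-distribˡ-sum)
  open import Algebra.Solver.Ring.NaturalCoefficients.Default commutativeSemiring
  open import Relation.Binary.Reasoning.Setoid setoid

  Σℕ : ℕ → (ℕ → Carrier) → Carrier
  Σℕ n g = sum {n} (g ∘ toℕ)

  Σℕ-cong : ∀ n {g h : ℕ → Carrier} → (∀ k → g k ≈ h k) → Σℕ n g ≈ Σℕ n h
  Σℕ-cong n g≈h = sum-cong-≋ {n} (g≈h ∘ toℕ)

  Σℕ-cong-< : ∀ n {g h : ℕ → Carrier} → (∀ {k} → k ℕ.< n → g k ≈ h k) → Σℕ n g ≈ Σℕ n h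
  Σℕ-cong-< n g≈h = sum-cong-≋ {n} (g≈h ∘ toℕ<n)

  Σℕ-+ : ∀ n (g h : ℕ → Carrier) → Σℕ n (λ k → g k + h k) ≈ Σℕ n g + Σℕ n h
  Σℕ-+ zero    g h = sym (+-identityʳ 0#)
  Σℕ-+ (suc n) g h = trans (+-congˡ (Σℕ-+ n (g ∘ suc) (h ∘ suc))) (interchange _ _ _ _)

  Σℕ-*ˡ : ∀ n a (g : ℕ → Carrier) → Σℕ n (λ k → a * g k) ≈ a * Σℕ n g
  Σℕ-*ˡ n a g = sym (*-distribˡ-sum {n} a (g ∘ toℕ))

  Σℕ-− : ∀ n (g h : ℕ → Carrier) → Σℕ n (λ k → g k - h k) ≈ Σℕ n g - Σℕ n h
  Σℕ-− n g h = trans (Σℕ-+ n g (λ k → - h k)) (+-congˡ Σℕ-neg)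
    where
    Σℕ-neg : Σℕ n (λ k → - h k) ≈ - Σℕ n h
    Σℕ-neg = begin
      Σℕ n (λ k → - h k)      ≈⟨ Σℕ-cong n (λ k → sym (-1*x≈-x (h k))) ⟩
      Σℕ n (λ k → - 1# * h k) ≈⟨ Σℕ-*ˡ n (- 1#) h ⟩
      - 1# * Σℕ n h           ≈⟨ -1*x≈-x _ ⟩
      - Σℕ n h                ∎

  Σℕ-snoc : ∀ n (g : ℕ → Carrier) → Σℕ (suc n) g ≈ Σℕ n g + g n
  Σℕ-snoc n g = trans (sum-init-last (g ∘ toℕ))
    (reflexive (≡.cong₂ _+_ (sum-cong-≗ {n} (≡.cong g ∘ toℕ-inject₁)) (≡.cong g (toℕ-fromℕ n))))

  sumTo-extend : ∀ {h : ℕ → Carrier} a m → a ℕ.≤ m → (∀ i → a ℕ.< i → h i ≈ 0#) →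
                 sumTo R m h ≈ sumTo R a h
  sumTo-extend zero    zero    _   _    = refl
  sumTo-extend a       (suc m) a≤m h≈0 with ℕₚ.m≤n⇒m<n∨m≡n a≤m
  ... | inj₂ ≡.refl         = refl
  ... | inj₁ (ℕ.s≤s a≤m′) =
    trans (+-cong (sumTo-extend a m a≤m′ h≈0) (h≈0 (suc m) (ℕ.s≤s a≤m′))) (+-identityʳ _)

  sumTo≈Σℕ : ∀ m (g : ℕ → Carrier) → sumTo R m g ≈ Σℕ (suc m) g
  sumTo≈Σℕ zero    g = sym (+-identityʳ (g 0))
  sumTo≈Σℕ (suc m) g = trans (+-congʳ (sumTo≈Σℕ m g)) (sym (Σℕ-snoc (suc m) g))

  ΣFin-cong : ∀ n {g h : Fin n → Carrier} → (∀ j → g j ≈ h j) → ΣFin R n g ≈ ΣFin R n h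
  ΣFin-cong zero    g≈h = refl
  ΣFin-cong (suc n) g≈h = +-cong (g≈h Fin.zero) (ΣFin-cong n (g≈h ∘ Fin.suc))

  ΣFin-≈0 : ∀ n {g : Fin n → Carrier} → (∀ j → g j ≈ 0#) → ΣFin R n g ≈ 0#
  ΣFin-≈0 zero    g≈0 = refl
  ΣFin-≈0 (suc n) g≈0 = trans (+-cong (g≈0 Fin.zero) (ΣFin-≈0 n (g≈0 ∘ Fin.suc))) (+-identityʳ 0#)

  det-cong : ∀ n {M N : Fin n → Fin n → Carrier} → (∀ i j → M i j ≈ N i j) → det R n M ≈ det R n N
  det-cong zero    M≈N = refl
  det-cong (suc n) M≈N = ΣFin-cong (suc n) λ j →
    *-congˡ {sgn R (toℕ j)} (*-cong (M≈N Fin.zero j) (det-cong n (λ a b → M≈N (Fin.suc a) (punchIn j b))))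

  detℕ : ℕ → (ℕ → ℕ → Carrier) → Carrier
  detℕ n f = det R n (λ i j → f (toℕ i) (toℕ j))

  minor₀₀ minor₀₁ : (ℕ → ℕ → Carrier) → ℕ → ℕ → Carrier
  minor₀₀ f i j = f (suc i) (suc j)
  minor₀₁ f i zero    = f (suc i) zero
  minor₀₁ f i (suc j) = f (suc i) (suc (suc j))

  record IsLowerHessenberg (f : ℕ → ℕ → Carrier) : Set ℓ where
    field
      above-superdiagonal : ∀ i k → f i (2 ℕ.+ i ℕ.+ k) ≈ 0#
      superdiagonal       : ∀ i → f i (suc i) ≈ - 1#

  open IsLowerHessenberg

  minor₀₀-isLowerHessenberg : ∀ {f} → IsLowerHessenberg f → IsLowerHessenberg (minor₀₀ f)
  minor₀₀-isLowerHessenberg H = record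
    { above-superdiagonal = above-superdiagonal H ∘ suc
    ; superdiagonal       = superdiagonal H ∘ suc
    }

  minor₀₁-isLowerHessenberg : ∀ {f} → IsLowerHessenberg f → IsLowerHessenberg (minor₀₁ f)
  minor₀₁-isLowerHessenberg H = record
    { above-superdiagonal = above-superdiagonal H ∘ suc
    ; superdiagonal       = superdiagonal H ∘ suc
    }

  -- With −1 on the superdiagonal, the (0,1) term (−1)¹ · (−1) · det minor₀₁ of the first-row
  -- expansion is det minor₀₁; a 1×1 matrix has no such term.
  expansionTerm₀₁ : (ℕ → ℕ → Carrier) → ℕ → Carrier
  expansionTerm₀₁ f zero    = 0#
  expansionTerm₀₁ f (suc m) = detℕ (suc m) (minor₀₁ f)

  det-firstRow : ∀ {f} → IsLowerHessenberg f → ∀ m →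
                 detℕ (suc m) f ≈ f 0 0 * detℕ m (minor₀₀ f) + expansionTerm₀₁ f m
  det-firstRow H zero    = +-congʳ (*-identityˡ _)
  det-firstRow {f} H (suc m) = +-cong (*-identityˡ _) (begin
    - 1# * (f 0 1 * D) + ΣFin R m _  ≈⟨ +-cong (-1*x≈-x _) (ΣFin-≈0 m λ j → rest-≈0 (toℕ j)) ⟩
    - (f 0 1 * D) + 0#               ≈⟨ +-identityʳ _ ⟩
    - (f 0 1 * D)                    ≈⟨ -‿cong (*-cong (superdiagonal H 0) (det-cong (suc m) λ a b →
                                          reflexive (punchIn₁-minor₀₁ (toℕ a) b))) ⟩
    - (- 1# * detℕ (suc m) (minor₀₁ f)) ≈⟨ -‿cong (-1*x≈-x _) ⟩
    - - detℕ (suc m) (minor₀₁ f)        ≈⟨ -‿involutive _ ⟩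
    detℕ (suc m) (minor₀₁ f)            ∎)
    where
    D : Carrier
    D = det R (suc m) (λ a b → f (suc (toℕ a)) (toℕ (punchIn (Fin.suc Fin.zero) b)))
    punchIn₁-minor₀₁ : ∀ i (b : Fin (suc m)) →
                       f (suc i) (toℕ (punchIn (Fin.suc Fin.zero) b)) ≡ minor₀₁ f i (toℕ b)
    punchIn₁-minor₀₁ i Fin.zero    = ≡.refl
    punchIn₁-minor₀₁ i (Fin.suc b) = ≡.refl
    rest-≈0 : ∀ k {d} → sgn R (2 ℕ.+ k) * (f 0 (2 ℕ.+ k) * d) ≈ 0#
    rest-≈0 k = trans (*-congˡ (trans (*-congʳ (above-superdiagonal H 0 k)) (zeroˡ _))) (zeroʳ _)

  det-lastRow : ∀ {f} → IsLowerHessenberg f → ∀ n →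
                detℕ (suc n) f ≈ Σℕ (suc n) (λ k → f n k * detℕ k f)
  det-lastRow H zero = det-firstRow H zero
  det-lastRow {f} H (suc n) = begin
    detℕ (2 ℕ.+ n) f
      ≈⟨ det-firstRow H (suc n) ⟩
    f 0 0 * detℕ (suc n) (minor₀₀ f) + detℕ (suc n) (minor₀₁ f)
      ≈⟨ +-cong (*-congˡ (det-lastRow (minor₀₀-isLowerHessenberg H) n))
                (det-lastRow (minor₀₁-isLowerHessenberg H) n) ⟩
    f 0 0 * S₀₀ + (f (suc n) 0 * 1# + S₀₁)
      ≈⟨ x+[y+z]≈y+[x+z] _ _ _ ⟩
    f (suc n) 0 * 1# + (f 0 0 * S₀₀ + S₀₁)
      ≈⟨ +-congˡ (sym tail-expansion) ⟩
    Σℕ (2 ℕ.+ n) (λ k → f (suc n) k * detℕ k f) ∎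
    where
    a : ℕ → Carrier
    a k = f (suc n) (suc k)
    S₀₀ S₀₁ : Carrier
    S₀₀ = Σℕ (suc n) (λ k → a k * detℕ k (minor₀₀ f))
    S₀₁ = Σℕ n (λ k → a (suc k) * detℕ (suc k) (minor₀₁ f))
    x+[y+z]≈y+[x+z] : ∀ x y z → x + (y + z) ≈ y + (x + z)
    x+[y+z]≈y+[x+z] = solve 3 (λ x y z → x :+ (y :+ z) := y :+ (x :+ z)) refl
    a*[b*d+e]≈b*[a*d]+a*e : ∀ a b d e → a * (b * d + e) ≈ b * (a * d) + a * e
    a*[b*d+e]≈b*[a*d]+a*e = solve 4 (λ a b d e → a :* (b :* d :+ e) := b :* (a :* d) :+ a :* e) refl
    tail-expansion : Σℕ (suc n) (λ k → a k * detℕ (suc k) f) ≈ f 0 0 * S₀₀ + S₀₁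
    tail-expansion = begin
      Σℕ (suc n) (λ k → a k * detℕ (suc k) f)
        ≈⟨ Σℕ-cong (suc n) (λ k →
             trans (*-congˡ (det-firstRow H k)) (a*[b*d+e]≈b*[a*d]+a*e (a k) (f 0 0) _ _)) ⟩
      Σℕ (suc n) (λ k → f 0 0 * (a k * detℕ k (minor₀₀ f)) + a k * expansionTerm₀₁ f k)
        ≈⟨ Σℕ-+ (suc n) (λ k → f 0 0 * (a k * detℕ k (minor₀₀ f))) (λ k → a k * expansionTerm₀₁ f k) ⟩
      Σℕ (suc n) (λ k → f 0 0 * (a k * detℕ k (minor₀₀ f))) + (a 0 * 0# + S₀₁)
        ≈⟨ +-cong (Σℕ-*ˡ (suc n) (f 0 0) (λ k → a k * detℕ k (minor₀₀ f)))
                  (trans (+-congʳ (zeroʳ _)) (+-identityˡ _)) ⟩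
      f 0 0 * S₀₀ + S₀₁ ∎

  det-unique : ∀ {f} → IsLowerHessenberg f → (K : ℕ → Carrier) → K 0 ≈ 1# →
               (∀ n → K (suc n) ≈ Σℕ (suc n) (λ k → f n k * K k)) →
               ∀ n → detℕ n f ≈ K n
  det-unique {f} H K K₀ Kₛ = <-rec (λ n → detℕ n f ≈ K n) det≈K
    where
    det≈K : ∀ n → (∀ {k} → k ℕ.< n → detℕ k f ≈ K k) → detℕ n f ≈ K n
    det≈K zero    _  = sym K₀
    det≈K (suc n) ih = begin
      detℕ (suc n) f                           ≈⟨ det-lastRow H n ⟩
      Σℕ (suc n) (λ k → f n k * detℕ k f)      ≈⟨ Σℕ-cong-< (suc n) (λ {k} k<n → *-congˡ {f n k} (ih k<n)) ⟩
      Σℕ (suc n) (λ k → f n k * K k)           ≈⟨ Kₛ n ⟨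
      K (suc n)                                ∎

  pow-+ : ∀ x m n → pow R x (m ℕ.+ n) ≈ pow R x m * pow R x n
  pow-+ x zero    n = sym (*-identityˡ _)
  pow-+ x (suc m) n = trans (*-congˡ (pow-+ x m n)) (sym (*-assoc _ _ _))

  module _ (q : Carrier) where

    qbin-0 : ∀ a → qbin R q a 0 ≈ 1#
    qbin-0 zero    = refl
    qbin-0 (suc a) = refl

    qbin-vanishes : ∀ {a m} → a ℕ.< m → qbin R q a m ≈ 0#
    qbin-vanishes {zero}  {suc m} _         = refl
    qbin-vanishes {suc a} {suc m} (ℕ.s≤s a<m) =
      trans (+-cong (qbin-vanishes a<m) (trans (*-congˡ (qbin-vanishes (ℕₚ.m<n⇒m<1+n a<m))) (zeroʳ _)))
            (+-identityʳ 0#)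

    qbin-diag : ∀ a → qbin R q a a ≈ 1#
    qbin-diag zero    = refl
    qbin-diag (suc a) =
      trans (+-cong (qbin-diag a) (trans (*-congˡ (qbin-vanishes (ℕₚ.n<1+n a))) (zeroʳ _))) (+-identityʳ 1#)

    qbin-dual-pascal : ∀ m b {a} → m ℕ.+ b ≡ a →
                   qbin R q (suc a) (suc m) ≈ qbin R q a (suc m) + pow R q b * qbin R q a m
    qbin-dual-pascal m zero ≡.refl rewrite ℕₚ.+-identityʳ m = begin
      qbin R q (suc m) (suc m)                               ≈⟨ qbin-diag (suc m) ⟩
      1#                                                     ≈⟨ *-identityˡ 1# ⟨
      1# * 1#                                                ≈⟨ +-identityˡ _ ⟨
      0# + 1# * 1#
        ≈⟨ +-cong (qbin-vanishes (ℕₚ.n<1+n m)) (*-congˡ (qbin-diag m)) ⟨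
      qbin R q m (suc m) + 1# * qbin R q m m                 ∎
    qbin-dual-pascal zero (suc b) ≡.refl = begin
      1# + q₁ * qbin R q (suc b) 1                           ≈⟨ +-congˡ (*-congˡ (qbin-dual-pascal zero b ≡.refl)) ⟩
      1# + q₁ * (qbin R q b 1 + pow R q b * qbin R q b 0)    ≈⟨ +-congˡ (*-congˡ (+-congˡ (*-congˡ (qbin-0 b)))) ⟩
      1# + q₁ * (qbin R q b 1 + pow R q b * 1#)              ≈⟨ regroup q (qbin R q b 1) (pow R q b) ⟩
      (1# + q₁ * qbin R q b 1) + (q * pow R q b) * 1#        ≈⟨ +-congʳ (+-congʳ (qbin-0 b)) ⟨
      qbin R q (suc b) 1 + pow R q (suc b) * qbin R q (suc b) 0 ∎
      where
      q₁ : Carrier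
      q₁ = q * 1#
      regroup : ∀ q y p → 1# + (q * 1#) * (y + p * 1#) ≈ (1# + (q * 1#) * y) + (q * p) * 1#
      regroup = solve 3 (λ q y p → con 1 :+ (q :* con 1) :* (y :+ p :* con 1)
                                  := (con 1 :+ (q :* con 1) :* y) :+ (q :* p) :* con 1) refl
    qbin-dual-pascal (suc m) (suc b) ≡.refl = begin
      qbin R q (suc A) (suc m) + pow R q (2 ℕ.+ m) * qbin R q (suc A) (2 ℕ.+ m)
        ≈⟨ +-cong (qbin-dual-pascal m (suc b) ≡.refl) (*-congˡ (qbin-dual-pascal (suc m) b (≡.sym (ℕₚ.+-suc m b)))) ⟩
      (X + (q * Pb) * Y) + (q * (q * Pm)) * (Z + Pb * X)
        ≈⟨ exchange q Pm Pb X Y Z ⟩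
      (X + (q * (q * Pm)) * Z) + (q * Pb) * (Y + (q * Pm) * X) ∎
      where
      A : ℕ
      A = m ℕ.+ suc b
      X Y Z Pm Pb : Carrier
      X  = qbin R q A (suc m)
      Y  = qbin R q A m
      Z  = qbin R q A (2 ℕ.+ m)
      Pm = pow R q m
      Pb = pow R q b
      exchange : ∀ q Pm Pb X Y Z → (X + (q * Pb) * Y) + (q * (q * Pm)) * (Z + Pb * X)
                                   ≈ (X + (q * (q * Pm)) * Z) + (q * Pb) * (Y + (q * Pm) * X)
      exchange = solve 6 (λ q Pm Pb X Y Z →
        (X :+ (q :* Pb) :* Y) :+ (q :* (q :* Pm)) :* (Z :+ Pb :* X)
        := (X :+ (q :* (q :* Pm)) :* Z) :+ (q :* Pb) :* (Y :+ (q :* Pm) :* X)) refl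

    module _ (x : Carrier) where

      propEntry : ℕ → ℕ → Carrier
      propEntry i j = qbin R q (suc i) (suc j) * (x * x) - qbinℤ R q i (ℤ.+ j ℤ.- ℤ.+ 1)

      propEntry-isLowerHessenberg : IsLowerHessenberg propEntry
      propEntry-isLowerHessenberg = record
        { above-superdiagonal = λ i k → begin
            qbin R q (suc i) (3 ℕ.+ i ℕ.+ k) * (x * x) - qbin R q i (suc i ℕ.+ k)
              ≈⟨ +-cong (0*y≈0 (qbin-vanishes (ℕ.s≤s (ℕ.s≤s (ℕₚ.m≤n⇒m≤1+n (ℕₚ.m≤m+n i k))))))
                        (trans (-‿cong (qbin-vanishes (ℕ.s≤s (ℕₚ.m≤m+n i k)))) -0#≈0#) ⟩
            0# + 0#                                 ≈⟨ +-identityʳ 0# ⟩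
            0#                                      ∎
        ; superdiagonal = λ i → begin
            qbin R q (suc i) (2 ℕ.+ i) * (x * x) - qbin R q i i
              ≈⟨ +-cong (0*y≈0 (qbin-vanishes (ℕₚ.n<1+n (suc i)))) (-‿cong (qbin-diag i)) ⟩
            0# - 1#                                 ≈⟨ +-identityˡ _ ⟩
            - 1#                                    ∎
        }
        where
        0*y≈0 : ∀ {a} → a ≈ 0# → a * (x * x) ≈ 0#
        0*y≈0 a≈0 = trans (*-congʳ a≈0) (zeroˡ _)

      record ThreeTermRecurrence (K : ℕ → Carrier) : Set ℓ where
        field
          recurrence-1 : K 1 ≈ (x * x) * K 0
          recurrence   : ∀ k → K (2 ℕ.+ k) ≈ (x * x) * K (suc k) + pow R q (suc k) * ((x * x) * K k)

      open ThreeTermRecurrence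

      -- By q-Pascal, [n+1, k+1] x² K k splits as A k + B k; the recurrence merges A (k+1) + B k
      -- into u (k+1), while C is u shifted by one place, so the row sum telescopes to u n.
      propEntry-rowSum : ∀ {K} → ThreeTermRecurrence K → ∀ n →
                         Σℕ (suc n) (λ k → propEntry n k * K k) ≈ K (suc n)
      propEntry-rowSum {K} T n = begin
        Σℕ (suc n) (λ k → propEntry n k * K k)        ≈⟨ Σℕ-cong (suc n) entry-split ⟩
        Σℕ (suc n) (λ k → (A k + B k) - C k)          ≈⟨ Σℕ-− (suc n) (λ k → A k + B k) C ⟩
        Σℕ (suc n) (λ k → A k + B k) - Σℕ (suc n) C   ≈⟨ +-cong (trans (Σℕ-+ (suc n) A B) ΣA+ΣB≈Σu)
                                                                (-‿cong ΣC≈Σu) ⟩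
        Σℕ (suc n) u - Σℕ n u                         ≈⟨ +-congʳ (Σℕ-snoc n u) ⟩
        (Σℕ n u + u n) - Σℕ n u                       ≈⟨ xyx⁻¹≈y _ _ ⟩
        u n                                           ≈⟨ trans (*-congʳ (qbin-diag n)) (*-identityˡ _) ⟩
        K (suc n)                                     ∎
        where
        y : Carrier
        y = x * x
        A B C u : ℕ → Carrier
        A k = qbin R q n k * (y * K k)
        B k = pow R q (suc k) * qbin R q n (suc k) * (y * K k)
        C k = qbinℤ R q n (ℤ.+ k ℤ.- ℤ.+ 1) * K k
        u k = qbin R q n k * K (suc k)

        expand : ∀ a p b y K → (a + p * b) * y * K ≈ a * (y * K) + p * b * (y * K)
        expand = solve 5 (λ a p b y K → (a :+ p :* b) :* y :* K
                                        := a :* (y :* K) :+ p :* b :* (y :* K)) refl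

        entry-split : ∀ k → propEntry n k * K k ≈ (A k + B k) - C k
        entry-split k = trans (distribʳ (K k) _ _)
          (+-cong (expand (qbin R q n k) (pow R q (suc k)) (qbin R q n (suc k)) y (K k))
                  (sym (-‿distribˡ-* _ _)))

        ΣC≈Σu : Σℕ (suc n) C ≈ Σℕ n u
        ΣC≈Σu = trans (+-congʳ (zeroˡ _)) (+-identityˡ _)

        Bn≈0 : B n ≈ 0#
        Bn≈0 = trans (*-congʳ (trans (*-congˡ (qbin-vanishes (ℕₚ.n<1+n n))) (zeroʳ _))) (zeroˡ _)

        factor : ∀ a Y₁ p Y₀ → a * Y₁ + p * a * Y₀ ≈ a * (Y₁ + p * Y₀)
        factor = solve 4 (λ a Y₁ p Y₀ → a :* Y₁ :+ p :* a :* Y₀ := a :* (Y₁ :+ p :* Y₀)) refl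

        ΣA+ΣB≈Σu : Σℕ (suc n) A + Σℕ (suc n) B ≈ Σℕ (suc n) u
        ΣA+ΣB≈Σu = begin
          (A 0 + Σℕ n (A ∘ suc)) + Σℕ (suc n) B
            ≈⟨ +-congˡ (trans (Σℕ-snoc n B) (trans (+-congˡ Bn≈0) (+-identityʳ _))) ⟩
          (A 0 + Σℕ n (A ∘ suc)) + Σℕ n B
            ≈⟨ +-assoc _ _ _ ⟩
          A 0 + (Σℕ n (A ∘ suc) + Σℕ n B)
            ≈⟨ +-cong (*-congˡ (sym (recurrence-1 T))) (sym (Σℕ-+ n (A ∘ suc) B)) ⟩
          u 0 + Σℕ n (λ k → A (suc k) + B k)
            ≈⟨ +-congˡ (Σℕ-cong n λ k →
                 trans (factor (qbin R q n (suc k)) (y * K (suc k)) (pow R q (suc k)) (y * K k))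
                       (*-congˡ (sym (recurrence T k)))) ⟩
          u 0 + Σℕ n (u ∘ suc) ∎

      Gterm : ℕ → ℕ → Carrier
      Gterm n j = pow R q (j ℕ.* j) * (qbin R q (n ℕ.∸ j) j * pow R x (n ℕ.∸ 2 ℕ.* j))

      Gterm-vanishes : ∀ n j → n ℕ.< 2 ℕ.* j → Gterm n j ≈ 0#
      Gterm-vanishes n j n<2j =
        trans (*-congˡ (trans (*-congʳ (qbin-vanishes (n<2*j⇒n∸j<j {n} {j} n<2j))) (zeroˡ _))) (zeroʳ _)

      G≈Σℕ : ∀ n m → n ℕ.≤ m → G R q x n ≈ Σℕ (suc m) (Gterm n)
      G≈Σℕ n m n≤m = trans (sym (sumTo-extend (n / 2) m (ℕₚ.≤-trans (m/n≤m n 2) n≤m)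
                                                   (λ i n/2<i → Gterm-vanishes n i (/2<⇒<2* n/2<i))))
                           (sumTo≈Σℕ m (Gterm n))

      Gterm-offset : ∀ j b →
                     Gterm (2 ℕ.* j ℕ.+ b) j ≡ pow R q (j ℕ.* j) * (qbin R q (j ℕ.+ b) j * pow R x b)
      Gterm-offset j b = ≡.cong₂ (λ s t → pow R q (j ℕ.* j) * (qbin R q s j * pow R x t))
                                 (2*j+b∸j≡j+b j b) (ℕₚ.m+n∸m≡n (2 ℕ.* j) b)

      x*Gterm-offset : ∀ j b → x * Gterm (suc (2 ℕ.* j ℕ.+ b)) (suc j)
                               ≈ pow R q (suc j ℕ.* suc j) * (qbin R q (j ℕ.+ b) (suc j) * pow R x b)
      x*Gterm-offset j zero = begin
        x * Gterm (suc (2 ℕ.* j ℕ.+ 0)) (suc j)    ≈⟨ *-congˡ (Gterm-vanishes _ (suc j) (1+[2*j+0]<2*[1+j] j)) ⟩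
        x * 0#                                    ≈⟨ zeroʳ x ⟩
        0#                                        ≈⟨ trans (*-congˡ (trans (*-congʳ (qbin-vanishes j+0<1+j)) (zeroˡ _)))
                                                           (zeroʳ _) ⟨
        pow R q (suc j ℕ.* suc j) * (qbin R q (j ℕ.+ 0) (suc j) * 1#) ∎
        where
        j+0<1+j : j ℕ.+ 0 ℕ.< suc j
        j+0<1+j = ℕ.s≤s (ℕₚ.≤-reflexive (ℕₚ.+-identityʳ j))
      x*Gterm-offset j (suc b) = begin
        x * Gterm (suc (2 ℕ.* j ℕ.+ suc b)) (suc j)
          ≡⟨ ≡.cong (λ n → x * Gterm n (suc j)) (1+[2*j+[1+b]]≡2*[1+j]+b j b) ⟩
        x * Gterm (2 ℕ.* suc j ℕ.+ b) (suc j)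
          ≡⟨ ≡.cong (x *_) (Gterm-offset (suc j) b) ⟩
        x * (Q * (qbin R q (suc (j ℕ.+ b)) (suc j) * pow R x b))
          ≈⟨ x*[Q*[Y*X]]≈Q*[Y*[x*X]] x Q _ _ ⟩
        Q * (qbin R q (suc (j ℕ.+ b)) (suc j) * pow R x (suc b))
          ≡⟨ ≡.cong (λ a → Q * (qbin R q a (suc j) * pow R x (suc b))) (ℕₚ.+-suc j b) ⟨
        Q * (qbin R q (j ℕ.+ suc b) (suc j) * pow R x (suc b)) ∎
        where
        Q : Carrier
        Q = pow R q (suc j ℕ.* suc j)
        x*[Q*[Y*X]]≈Q*[Y*[x*X]] : ∀ x Q Y X → x * (Q * (Y * X)) ≈ Q * (Y * (x * X))
        x*[Q*[Y*X]]≈Q*[Y*[x*X]] = solve 4 (λ x Q Y X → x :* (Q :* (Y :* X)) := Q :* (Y :* (x :* X))) refl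

      Gterm-rec-offset : ∀ j b → let n = 2 ℕ.* j ℕ.+ b in
        Gterm (2 ℕ.+ n) (suc j) ≈ x * Gterm (suc n) (suc j) + pow R q (suc n) * Gterm n j
      Gterm-rec-offset j b = begin
        Gterm (2 ℕ.+ n) (suc j)                     ≡⟨ ≡.cong (λ m → Gterm m (suc j)) (2+[2*j+b]≡2*[1+j]+b j b) ⟩
        Gterm (2 ℕ.* suc j ℕ.+ b) (suc j)           ≡⟨ Gterm-offset (suc j) b ⟩
        Q * (qbin R q (suc (j ℕ.+ b)) (suc j) * X)  ≈⟨ *-congˡ (*-congʳ (qbin-dual-pascal j b ≡.refl)) ⟩
        Q * ((Y + P * Z) * X)                       ≈⟨ distribute Q Y P Z X ⟩
        Q * (Y * X) + Q * P * (Z * X)               ≈⟨ +-cong (x*Gterm-offset j b) exponents ⟨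
        x * Gterm (suc n) (suc j) + pow R q (suc n) * (pow R q (j ℕ.* j) * (Z * X))
          ≡⟨ ≡.cong (λ t → x * Gterm (suc n) (suc j) + pow R q (suc n) * t) (Gterm-offset j b) ⟨
        x * Gterm (suc n) (suc j) + pow R q (suc n) * Gterm n j ∎
        where
        n : ℕ
        n = 2 ℕ.* j ℕ.+ b
        Q X Y Z P : Carrier
        Q = pow R q (suc j ℕ.* suc j)
        X = pow R x b
        Y = qbin R q (j ℕ.+ b) (suc j)
        Z = qbin R q (j ℕ.+ b) j
        P = pow R q b
        distribute : ∀ Q Y P Z X → Q * ((Y + P * Z) * X) ≈ Q * (Y * X) + Q * P * (Z * X)
        distribute = solve 5 (λ Q Y P Z X → Q :* ((Y :+ P :* Z) :* X)
                                            := Q :* (Y :* X) :+ Q :* P :* (Z :* X)) refl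
        exponents : pow R q (suc n) * (pow R q (j ℕ.* j) * (Z * X)) ≈ Q * P * (Z * X)
        exponents = begin
          pow R q (suc n) * (pow R q (j ℕ.* j) * (Z * X))  ≈⟨ *-assoc _ _ _ ⟨
          pow R q (suc n) * pow R q (j ℕ.* j) * (Z * X)    ≈⟨ *-congʳ (pow-+ q (suc n) (j ℕ.* j)) ⟨
          pow R q (suc n ℕ.+ j ℕ.* j) * (Z * X)
            ≡⟨ ≡.cong (λ e → pow R q e * (Z * X)) (1+[2*j+b]+j*j≡[1+j]*[1+j]+b j b) ⟩
          pow R q (suc j ℕ.* suc j ℕ.+ b) * (Z * X)        ≈⟨ *-congʳ (pow-+ q (suc j ℕ.* suc j) b) ⟩
          Q * P * (Z * X)                                  ∎

      Gterm-rec : ∀ n j →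
        Gterm (2 ℕ.+ n) (suc j) ≈ x * Gterm (suc n) (suc j) + pow R q (suc n) * Gterm n j
      Gterm-rec n j with n ℕ.<? 2 ℕ.* j
      ... | yes n<2j = begin
        Gterm (2 ℕ.+ n) (suc j)  ≈⟨ Gterm-vanishes _ (suc j) 2+n<2[1+j] ⟩
        0#                       ≈⟨ +-identityʳ 0# ⟨
        0# + 0#                  ≈⟨ +-cong (x*0≈0 (Gterm-vanishes _ (suc j) 1+n<2[1+j]))
                                           (x*0≈0 (Gterm-vanishes n j n<2j)) ⟨
        x * Gterm (suc n) (suc j) + pow R q (suc n) * Gterm n j ∎
        where
        2+n<2[1+j] : 2 ℕ.+ n ℕ.< 2 ℕ.* suc j
        2+n<2[1+j] = n<2*j⇒2+n<2*[1+j] n<2j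
        1+n<2[1+j] : suc n ℕ.< 2 ℕ.* suc j
        1+n<2[1+j] = ℕₚ.<-trans (ℕₚ.n<1+n (suc n)) 2+n<2[1+j]
        x*0≈0 : ∀ {a b} → b ≈ 0# → a * b ≈ 0#
        x*0≈0 b≈0 = trans (*-congˡ b≈0) (zeroʳ _)
      ... | no n≮2j with ℕₚ.m≤n⇒∃[o]m+o≡n (ℕₚ.≮⇒≥ n≮2j)
      ...   | b , ≡.refl = Gterm-rec-offset j b

      Gterm-suc-0 : ∀ n → Gterm (suc n) 0 ≈ x * Gterm n 0
      Gterm-suc-0 n = begin
        1# * (1# * (x * pow R x n))            ≈⟨ trans (*-identityˡ _) (*-identityˡ _) ⟩
        x * pow R x n                          ≈⟨ *-congˡ (trans (*-identityˡ _)
                                                                 (trans (*-congʳ (qbin-0 n)) (*-identityˡ _))) ⟨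
        x * (1# * (qbin R q n 0 * pow R x n))  ∎

      G-rec : ∀ n → G R q x (2 ℕ.+ n) ≈ x * G R q x (suc n) + pow R q (suc n) * G R q x n
      G-rec n = begin
        G R q x (2 ℕ.+ n)
          ≈⟨ G≈Σℕ (2 ℕ.+ n) (2 ℕ.+ n) ℕₚ.≤-refl ⟩
        Gterm (2 ℕ.+ n) 0 + Σℕ (2 ℕ.+ n) (λ j → Gterm (2 ℕ.+ n) (suc j))
          ≈⟨ +-cong (Gterm-suc-0 (suc n)) (Σℕ-cong (2 ℕ.+ n) (Gterm-rec n)) ⟩
        x * Gterm (suc n) 0 + Σℕ (2 ℕ.+ n) (λ j → x * Gterm (suc n) (suc j) + p * Gterm n j)
          ≈⟨ +-congˡ (trans (Σℕ-+ (2 ℕ.+ n) (λ j → x * Gterm (suc n) (suc j)) (λ j → p * Gterm n j))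
                            (+-cong (Σℕ-*ˡ (2 ℕ.+ n) x (Gterm (suc n) ∘ suc)) (Σℕ-*ˡ (2 ℕ.+ n) p (Gterm n)))) ⟩
        x * Gterm (suc n) 0 + (x * Σℕ (2 ℕ.+ n) (Gterm (suc n) ∘ suc) + p * Σℕ (2 ℕ.+ n) (Gterm n))
          ≈⟨ trans (+-congʳ (distribˡ x _ _)) (+-assoc _ _ _) ⟨
        x * Σℕ (3 ℕ.+ n) (Gterm (suc n)) + p * Σℕ (2 ℕ.+ n) (Gterm n)
          ≈⟨ +-cong (*-congˡ (G≈Σℕ (suc n) (2 ℕ.+ n) (ℕₚ.n≤1+n _)))
                    (*-congˡ (G≈Σℕ n (suc n) (ℕₚ.n≤1+n n))) ⟨
        x * G R q x (suc n) + p * G R q x n ∎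
        where
        p : Carrier
        p = pow R q (suc n)

      xⁿGₙ : ℕ → Carrier
      xⁿGₙ n = pow R x n * G R q x n

      xⁿGₙ-0 : xⁿGₙ 0 ≈ 1#
      xⁿGₙ-0 = trans (*-identityˡ _) (trans (*-identityˡ _) (*-identityˡ _))

      xⁿGₙ-threeTermRecurrence : ThreeTermRecurrence xⁿGₙ
      xⁿGₙ-threeTermRecurrence = record
        { recurrence-1 = trans (*-congˡ (Gterm-suc-0 0)) (rearrange₁ x (G R q x 0))
        ; recurrence   = λ k → trans (*-congˡ (G-rec k))
                                     (rearrange x (pow R x k) (G R q x (suc k)) (pow R q (suc k)) (G R q x k))
        }
        where
        rearrange₁ : ∀ x G₀ → (x * 1#) * (x * G₀) ≈ (x * x) * (1# * G₀)
        rearrange₁ = solve 2 (λ x G₀ → (x :* con 1) :* (x :* G₀) := (x :* x) :* (con 1 :* G₀)) refl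
        rearrange : ∀ x X G₁ P G₀ →
                    x * (x * X) * (x * G₁ + P * G₀) ≈ (x * x) * ((x * X) * G₁) + P * ((x * x) * (X * G₀))
        rearrange = solve 5 (λ x X G₁ P G₀ → x :* (x :* X) :* (x :* G₁ :+ P :* G₀)
                                             := (x :* x) :* ((x :* X) :* G₁) :+ P :* ((x :* x) :* (X :* G₀))) refl

proposition8 : {c ℓ : Level} (R : CommutativeRing c ℓ) (q x : CommutativeRing.Carrier R) (n : ℕ) →
    CommutativeRing._≈_ R (det R n (propMatrix R q x n)) (CommutativeRing._*_ R (pow R x n) (G R q x n))
proposition8 R q x n =
  det-unique R (propEntry-isLowerHessenberg R q x) (xⁿGₙ R q x) (xⁿGₙ-0 R q x)
    (λ m → CommutativeRing.sym R (propEntry-rowSum R q x (xⁿGₙ-threeTermRecurrence R q x) m)) n
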